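{- There exists a real binary sextic form $q\in F_{2,6}$ having two distinct signatures, i.e. with $|\mathcal S(q)|\ge 2$.
   Context: $F_{2,2s}$ denotes the set of real binary forms $p(x,y)$ of degree $2s$. A representation of $p$ is an identity $p(x,y)=\sum_{j=1}^r \lambda_j(\alpha_j x+\beta_j y)^{2s}$ with $\alpha_j,\beta_j\in\mathbb R$ and $0\neq\lambda_j\in\mathbb R$. It has badge $(a,b)$ if exactly $a$ of the $\lambda_j$ are positive and $b$ are negative. It is honest if no two of the linear forms $\alpha_j x+\beta_j y$ are proportional. $\mathcal B(p)$ is the set of badges of honest representations of $p$. Badges are ordered componentwise: $(a,b)\preceq(c,d)$ iff $a\le c$ and $b\le d$. A signature of $p$ is a minimal element of $\mathcal B(p)$ under $\preceq$, and $\mathcal S(p)$ is the set of signatures of $p$. -}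

module Defs where

open import Level using (0ℓ) renaming (suc to lsuc)
open import Algebra.Bundles using (CommutativeRing)
open import Relation.Binary.Structures using (IsStrictTotalOrder)
open import Data.Nat using (ℕ; zero; suc; _∸_) renaming (_≤_ to _≤ℕ_; _*_ to _*ℕ_)
open import Data.Nat.Combinatorics using (_C_)
open import Data.Fin using (Fin; toℕ)
open import Data.List using (List; []; _∷_; _++_; length)
open import Data.List.Relation.Unary.All using (All)
open import Data.List.Relation.Unary.AllPairs using (AllPairs)
open import Data.Product using (Σ; ∃; _×_; _,_)
open import Data.Sum using (_⊎_)
open import Relation.Nullary using (¬_)
open import Relation.Binary.PropositionalEquality using (_≡_)

-- An axiomatic model of the real numbers: a complete ordered field.
-- (Any two such structures are isomorphic, so quantifying over all of
-- them is the same as speaking about ℝ.)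
record RealField : Set₁ where
  field
    commutativeRing : CommutativeRing 0ℓ 0ℓ
  open CommutativeRing commutativeRing public
  field
    _<_            : Carrier → Carrier → Set
    isStrictTotalOrder : IsStrictTotalOrder _≈_ _<_
    0<1            : 0# < 1#
    +-mono-<       : ∀ {x y} z → x < y → (x + z) < (y + z)
    *-pos          : ∀ {x y} → 0# < x → 0# < y → 0# < (x * y)
    inverse        : ∀ x → ¬ (x ≈ 0#) → ∃ λ y → (x * y) ≈ 1#
  _≤ᵣ_ : Carrier → Carrier → Set
  x ≤ᵣ y = (x < y) ⊎ (x ≈ y)
  IsUpperBound : (Carrier → Set) → Carrier → Set
  IsUpperBound S u = ∀ x → S x → x ≤ᵣ u
  field
    completeness : (S : Carrier → Set) → ∃ S → ∃ (IsUpperBound S) →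
                   ∃ λ s → IsUpperBound S s × (∀ u → IsUpperBound S u → s ≤ᵣ u)

module Forms (R : RealField) where
  open RealField R

  _·_ : ℕ → Carrier → Carrier
  zero · x = 0#
  suc n · x = x + (n · x)

  _^'_ : Carrier → ℕ → Carrier
  x ^' zero = 1#
  x ^' suc n = x * (x ^' n)

  -- A binary form of degree n: p(x,y) = Σ_k (coeff k) x^(n-k) y^k,
  -- given by its n+1 coefficients.
  Form : ℕ → Set
  Form n = Fin (suc n) → Carrier

  -- A term λ (α x + β y)^n, stored as (λ , α , β).
  Term : Set
  Term = Carrier × Carrier × Carrier

  coeff : Term → Carrier
  coeff (l , _ , _) = l

  termCoeff : (n : ℕ) → Term → ℕ → Carrier
  termCoeff n (l , a , b) k = l * ((n C k) · ((a ^' (n ∸ k)) * (b ^' k)))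

  sumCoeff : (n : ℕ) → List Term → ℕ → Carrier
  sumCoeff n [] k = 0#
  sumCoeff n (t ∷ ts) k = termCoeff n t k + sumCoeff n ts k

  Proportional : Term → Term → Set
  Proportional (_ , a , b) (_ , a' , b') = (a * b') ≈ (a' * b)

  HasBadge : {n : ℕ} → Form n → ℕ → ℕ → Set
  HasBadge {n} p a b =
    Σ (List Term) λ P → Σ (List Term) λ N →
      length P ≡ a × length N ≡ b ×
      All (λ t → 0# < coeff t) P × All (λ t → coeff t < 0#) N ×
      AllPairs (λ s t → ¬ Proportional s t) (P ++ N) ×
      (∀ (k : Fin (suc n)) → p k ≈ sumCoeff n (P ++ N) (toℕ k))

  IsSignature : {n : ℕ} → Form n → ℕ → ℕ → Set
  IsSignature p a b =
    HasBadge p a b ×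
    (∀ c d → HasBadge p c d → c ≤ℕ a → d ≤ℕ b → (c ≡ a × d ≡ b))

-- Write a sextic as Σ C(6,k) a_k x^(6-k) y^k; for q = 6κ₁ x⁵y + 6κ₅ xy⁵ (κ₁, κ₅ > 0) the sequence
-- a is (0, κ₁, 0, 0, 0, κ₅, 0). Explicit honest representations of q with badges (3,2) and (2,3)
-- exist, so both are signatures as soon as every honest representation has at least five terms.
-- Suppose q = Σ λⱼ (αⱼ x + βⱼ y)⁶ with at most four pairwise non-proportional points (αⱼ, βⱼ).
-- Apolarity gives Σᵢ wᵢ a_(k+i) = Σⱼ λⱼ αⱼ^(3-k) βⱼ^k w(αⱼ, βⱼ) for every binary cubic w. Taking
-- for w a product of lines through all points but the last one, s = (a, b), only s survives, and
-- the four resulting equations force (b x + a y)(κ₅ (a x)² + κ₁ (b y)²) = 0 at every root (x, y)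
-- of w. No two roots that are non-proportional to each other and to s can satisfy this. One term
-- would give a₁² = a₀ a₂ and no term a₁ = 0, both false for q.

module Submission where

open import Defs
open import Algebra.Bundles using (CommutativeRing)
import Algebra.Solver.Ring
open import Algebra.Solver.Ring.AlmostCommutativeRing using (fromCommutativeRing; _-Raw-AlmostCommutative⟶_)
open import Data.Nat as ℕ using (ℕ; zero; suc; _∸_)
import Data.Nat.Properties as ℕₚ
open import Data.Integer as ℤ using (ℤ; +_; -[1+_]; _⊖_)
import Data.Integer.Properties as ℤₚ
open import Data.Sign as Sign using (Sign)
open import Data.Maybe using (Maybe; just; nothing)
open import Data.Nat.Combinatorics using (_C_)
open import Data.Fin using (Fin; toℕ)
import Data.Fin.Properties as Finₚ
open import Data.Fin.Patterns using (0F; 1F; 2F; 3F; 4F; 5F; 6F)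
open import Data.List using (List; []; _∷_; _++_; length; map)
import Data.List.Properties as Listₚ
open import Data.List.Relation.Unary.All as All using (All; []; _∷_)
import Data.List.Relation.Unary.All.Properties as Allₚ
open import Data.List.Relation.Unary.AllPairs as AllPairs using (AllPairs; []; _∷_)
import Data.List.Relation.Unary.AllPairs.Properties as AllPairsₚ
open import Data.Product using (Σ; _×_; _,_; proj₁; proj₂)
open import Relation.Nullary using (¬_; ¬?; Dec; yes; no; contradiction)
open import Relation.Nullary.Decidable using (True; toWitness; from-yes)
open import Relation.Binary.Structures using (IsStrictTotalOrder)
open import Relation.Binary.Definitions using (tri<; tri≈; tri>)
open import Data.Sum as Sum using (_⊎_; inj₁; inj₂)
open import Data.Empty using (⊥; ⊥-elim)
open import Relation.Binary.PropositionalEquality as ≡ using (_≡_)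

≤-sum-squeeze : ∀ {a b c d} → c ℕ.≤ a → d ℕ.≤ b → a ℕ.+ b ℕ.≤ c ℕ.+ d → c ≡ a × d ≡ b
≤-sum-squeeze c≤a d≤b a+b≤c+d =
  ℕₚ.≤-antisym c≤a (ℕₚ.≮⇒≥ λ c<a → ℕₚ.<⇒≱ (ℕₚ.+-mono-<-≤ c<a d≤b) a+b≤c+d) ,
  ℕₚ.≤-antisym d≤b (ℕₚ.≮⇒≥ λ d<b → ℕₚ.<⇒≱ (ℕₚ.+-mono-≤-< c≤a d<b) a+b≤c+d)

module IntegerEmbedding {c ℓ} (R : CommutativeRing c ℓ) where
  open CommutativeRing R
  open import Algebra.Properties.Ring ring using (-0#≈0#; -‿+-comm; -‿involutive; -1*x≈-x)
  open import Algebra.Properties.Monoid.Mult +-monoid using (×-homo-+) renaming (_×_ to _⊗_)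
  open import Algebra.Properties.Semiring.Mult semiring using (×1-homo-*)
  open import Algebra.Properties.CommutativeSemigroup +-commutativeSemigroup using () renaming (interchange to +-interchange)
  open import Algebra.Properties.CommutativeSemigroup *-commutativeSemigroup using () renaming (interchange to *-interchange)
  open import Relation.Binary.Reasoning.Setoid setoid

  fromℕ : ℕ → Carrier
  fromℕ n = n ⊗ 1#

  fromℕ-* : ∀ m n → fromℕ (m ℕ.* n) ≈ fromℕ m * fromℕ n
  fromℕ-* = ×1-homo-*

  fromℤ : ℤ → Carrier
  fromℤ (+ n)    = fromℕ n
  fromℤ -[1+ n ] = - fromℕ (suc n)

  fromℤ-⊖ : ∀ m n → fromℤ (m ⊖ n) ≈ fromℕ m - fromℕ n
  fromℤ-⊖ zero    zero    = sym (-‿inverseʳ 0#)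
  fromℤ-⊖ (suc m) zero    = sym (trans (+-congˡ -0#≈0#) (+-identityʳ _))
  fromℤ-⊖ zero    (suc n) = sym (+-identityˡ _)
  fromℤ-⊖ (suc m) (suc n) = begin
    fromℤ (suc m ⊖ suc n)              ≡⟨ ≡.cong fromℤ (ℤₚ.[1+m]⊖[1+n]≡m⊖n m n) ⟩
    fromℤ (m ⊖ n)                      ≈⟨ fromℤ-⊖ m n ⟩
    fromℕ m - fromℕ n                  ≈⟨ +-identityˡ _ ⟨
    0# + (fromℕ m - fromℕ n)           ≈⟨ +-congʳ (-‿inverseʳ 1#) ⟨
    (1# - 1#) + (fromℕ m - fromℕ n)    ≈⟨ +-interchange 1# (- 1#) (fromℕ m) (- fromℕ n) ⟩
    (1# + fromℕ m) + (- 1# - fromℕ n)  ≈⟨ +-congˡ (-‿+-comm 1# (fromℕ n)) ⟩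
    fromℕ (suc m) - fromℕ (suc n)      ∎

  fromℤ-+ : ∀ i j → fromℤ (i ℤ.+ j) ≈ fromℤ i + fromℤ j
  fromℤ-+ (+ m)    (+ n)    = ×-homo-+ 1# m n
  fromℤ-+ (+ m)    -[1+ n ] = fromℤ-⊖ m (suc n)
  fromℤ-+ -[1+ m ] (+ n)    = trans (fromℤ-⊖ n (suc m)) (+-comm _ _)
  fromℤ-+ -[1+ m ] -[1+ n ] = begin
    - fromℕ (suc (suc (m ℕ.+ n)))     ≡⟨ ≡.cong (λ k → - fromℕ k) (ℕₚ.+-suc (suc m) n) ⟨
    - fromℕ (suc m ℕ.+ suc n)         ≈⟨ -‿cong (×-homo-+ 1# (suc m) (suc n)) ⟩
    - (fromℕ (suc m) + fromℕ (suc n)) ≈⟨ -‿+-comm _ _ ⟨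
    - fromℕ (suc m) - fromℕ (suc n)   ∎

  fromℤ-neg : ∀ i → fromℤ (ℤ.- i) ≈ - fromℤ i
  fromℤ-neg (+ zero)  = sym -0#≈0#
  fromℤ-neg (+ suc n) = refl
  fromℤ-neg -[1+ n ]  = sym (-‿involutive _)

  fromSign : Sign → Carrier
  fromSign Sign.+ = 1#
  fromSign Sign.- = - 1#

  fromSign-* : ∀ s t → fromSign (s Sign.* t) ≈ fromSign s * fromSign t
  fromSign-* Sign.+ t      = sym (*-identityˡ _)
  fromSign-* Sign.- Sign.+ = sym (*-identityʳ _)
  fromSign-* Sign.- Sign.- = sym (trans (-1*x≈-x (- 1#)) (-‿involutive 1#))

  fromℤ-◃ : ∀ s n → fromℤ (s ℤ.◃ n) ≈ fromSign s * fromℕ n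
  fromℤ-◃ s      zero    = sym (zeroʳ _)
  fromℤ-◃ Sign.+ (suc n) = sym (*-identityˡ _)
  fromℤ-◃ Sign.- (suc n) = sym (-1*x≈-x _)

  fromℤ≈sign*abs : ∀ i → fromℤ i ≈ fromSign (ℤ.sign i) * fromℕ ℤ.∣ i ∣
  fromℤ≈sign*abs i = trans (reflexive (≡.cong fromℤ (≡.sym (ℤₚ.◃-inverse i)))) (fromℤ-◃ (ℤ.sign i) ℤ.∣ i ∣)

  fromℤ-* : ∀ i j → fromℤ (i ℤ.* j) ≈ fromℤ i * fromℤ j
  fromℤ-* i j = begin
    fromℤ (i ℤ.* j)                                              ≈⟨ fromℤ-◃ (ℤ.sign i Sign.* ℤ.sign j) (ℤ.∣ i ∣ ℕ.* ℤ.∣ j ∣) ⟩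
    fromSign (ℤ.sign i Sign.* ℤ.sign j) * fromℕ (ℤ.∣ i ∣ ℕ.* ℤ.∣ j ∣) ≈⟨ *-cong (fromSign-* (ℤ.sign i) (ℤ.sign j)) (×1-homo-* ℤ.∣ i ∣ ℤ.∣ j ∣) ⟩
    (fromSign (ℤ.sign i) * fromSign (ℤ.sign j)) * (fromℕ ℤ.∣ i ∣ * fromℕ ℤ.∣ j ∣) ≈⟨ *-interchange _ _ _ _ ⟩
    (fromSign (ℤ.sign i) * fromℕ ℤ.∣ i ∣) * (fromSign (ℤ.sign j) * fromℕ ℤ.∣ j ∣) ≈⟨ *-cong (fromℤ≈sign*abs i) (fromℤ≈sign*abs j) ⟨
    fromℤ i * fromℤ j                                            ∎

  fromℤ-morphism : ℤ.+-*-rawRing -Raw-AlmostCommutative⟶ fromCommutativeRing R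
  fromℤ-morphism = record
    { ⟦_⟧    = fromℤ
    ; +-homo = fromℤ-+
    ; *-homo = fromℤ-*
    ; -‿homo = fromℤ-neg
    ; 0-homo = refl
    ; 1-homo = +-identityʳ 1#
    }

  fromℤ-≈? : ∀ i j → Maybe (fromℤ i ≈ fromℤ j)
  fromℤ-≈? i j with i ℤ.≟ j
  ... | yes ≡.refl = just refl
  ... | no _       = nothing

  module ℤ-Solver = Algebra.Solver.Ring ℤ.+-*-rawRing (fromCommutativeRing R) fromℤ-morphism fromℤ-≈?

module RealFieldProperties (R : RealField) where
  open RealField R
  open IntegerEmbedding commutativeRing
  open import Algebra.Properties.Ring ring using (x[y-z]≈xy-xz; x∙y⁻¹≈ε⇒x≈y)
  open import Relation.Binary.Reasoning.Setoid setoid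
  private module < = IsStrictTotalOrder isStrictTotalOrder

  <⇒≉ : ∀ {x y} → x < y → x ≉ y
  <⇒≉ x<y x≈y = <.irrefl x≈y x<y

  >0⇒≉0 : ∀ {x} → 0# < x → x ≉ 0#
  >0⇒≉0 0<x x≈0 = <⇒≉ 0<x (sym x≈0)

  <0⇒≉0 : ∀ {x} → x < 0# → x ≉ 0#
  <0⇒≉0 = <⇒≉

  ≉⇒-≉0 : ∀ {x y} → x ≉ y → x - y ≉ 0#
  ≉⇒-≉0 {x} {y} x≉y x-y≈0 = x≉y (x∙y⁻¹≈ε⇒x≈y x y x-y≈0)

  ≈0⊎≉0 : ∀ x → x ≈ 0# ⊎ x ≉ 0#
  ≈0⊎≉0 x with <.compare x 0#
  ... | tri< x<0 _ _ = inj₂ (<0⇒≉0 x<0)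
  ... | tri≈ _ x≈0 _ = inj₁ x≈0
  ... | tri> _ _ 0<x = inj₂ (>0⇒≉0 0<x)

  *-cancelˡ-≈0 : ∀ {x y} → x ≉ 0# → x * y ≈ 0# → y ≈ 0#
  *-cancelˡ-≈0 {x} {y} x≉0 xy≈0 with inverse x x≉0
  ... | x⁻¹ , xx⁻¹≈1 = begin
    y               ≈⟨ *-identityˡ y ⟨
    1# * y          ≈⟨ *-congʳ (trans (sym xx⁻¹≈1) (*-comm x x⁻¹)) ⟩
    (x⁻¹ * x) * y   ≈⟨ *-assoc x⁻¹ x y ⟩
    x⁻¹ * (x * y)   ≈⟨ *-congˡ xy≈0 ⟩
    x⁻¹ * 0#        ≈⟨ zeroʳ x⁻¹ ⟩
    0#              ∎

  *-cancelʳ-≈0 : ∀ {x y} → y ≉ 0# → x * y ≈ 0# → x ≈ 0#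
  *-cancelʳ-≈0 {x} {y} y≉0 xy≈0 = *-cancelˡ-≈0 y≉0 (trans (*-comm y x) xy≈0)

  *-cancelˡ : ∀ {c x y} → c ≉ 0# → c * x ≈ c * y → x ≈ y
  *-cancelˡ {c} {x} {y} c≉0 cx≈cy = x∙y⁻¹≈ε⇒x≈y x y (*-cancelˡ-≈0 c≉0 (begin
    c * (x - y)     ≈⟨ x[y-z]≈xy-xz c x y ⟩
    c * x - c * y   ≈⟨ +-congʳ cx≈cy ⟩
    c * y - c * y   ≈⟨ -‿inverseʳ (c * y) ⟩
    0#              ∎))

  zero-product : ∀ {x y} → x * y ≈ 0# → x ≈ 0# ⊎ y ≈ 0#
  zero-product {x} xy≈0 with ≈0⊎≉0 x
  ... | inj₁ x≈0 = inj₁ x≈0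
  ... | inj₂ x≉0 = inj₂ (*-cancelˡ-≈0 x≉0 xy≈0)

  *-≉0 : ∀ {x y} → x ≉ 0# → y ≉ 0# → x * y ≉ 0#
  *-≉0 x≉0 y≉0 xy≈0 = x≉0 (*-cancelʳ-≈0 y≉0 xy≈0)

  -‿>0 : ∀ {x} → x < 0# → 0# < (- x)
  -‿>0 {x} x<0 = <.<-respʳ-≈ (+-identityˡ (- x)) (<.<-respˡ-≈ (-‿inverseʳ x) (+-mono-< (- x) x<0))

  -‿<0 : ∀ {x} → 0# < x → (- x) < 0#
  -‿<0 {x} 0<x = <.<-respˡ-≈ (+-identityˡ (- x)) (<.<-respʳ-≈ (-‿inverseʳ x) (+-mono-< (- x) 0<x))

  -x*-x≈x*x : ∀ x → - x * - x ≈ x * x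
  -x*-x≈x*x = solve 1 (λ x → :- x :* :- x := x :* x) refl
    where open ℤ-Solver

  x≉0⇒0<x*x : ∀ {x} → x ≉ 0# → 0# < (x * x)
  x≉0⇒0<x*x {x} x≉0 with <.compare x 0#
  ... | tri< x<0 _ _ = <.<-respʳ-≈ (-x*-x≈x*x x) (*-pos (-‿>0 x<0) (-‿>0 x<0))
  ... | tri≈ _ x≈0 _ = contradiction x≈0 x≉0
  ... | tri> _ _ 0<x = *-pos 0<x 0<x

  0≤x*x : ∀ x → 0# ≤ᵣ (x * x)
  0≤x*x x with ≈0⊎≉0 x
  ... | inj₁ x≈0 = inj₂ (sym (trans (*-congʳ x≈0) (zeroˡ x)))
  ... | inj₂ x≉0 = inj₁ (x≉0⇒0<x*x x≉0)

  *-mono-≥0 : ∀ {c x} → 0# < c → 0# ≤ᵣ x → 0# ≤ᵣ (c * x)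
  *-mono-≥0 0<c (inj₁ 0<x)     = inj₁ (*-pos 0<c 0<x)
  *-mono-≥0 {c} 0<c (inj₂ 0≈x) = inj₂ (sym (trans (*-congˡ (sym 0≈x)) (zeroʳ c)))

  >0+≥0⇒>0 : ∀ {x y} → 0# < x → 0# ≤ᵣ y → 0# < (x + y)
  >0+≥0⇒>0 {x} 0<x (inj₂ 0≈y) = <.<-respʳ-≈ (trans (sym (+-identityʳ x)) (+-congˡ 0≈y)) 0<x
  >0+≥0⇒>0 {x} {y} 0<x (inj₁ 0<y) = <.trans (<.<-respʳ-≈ (sym (+-identityˡ y)) 0<y) (+-mono-< y 0<x)

  weighted-squares-≈0 : ∀ {p q u v} → 0# < p → 0# < q → p * (u * u) + q * (v * v) ≈ 0# → u ≈ 0# × v ≈ 0#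
  weighted-squares-≈0 0<p 0<q sum≈0 =
    first 0<p 0<q sum≈0 , first 0<q 0<p (trans (+-comm _ _) sum≈0)
    where
    first : ∀ {p q u v} → 0# < p → 0# < q → p * (u * u) + q * (v * v) ≈ 0# → u ≈ 0#
    first {u = u} {v} 0<p 0<q sum≈0 with ≈0⊎≉0 u
    ... | inj₁ u≈0 = u≈0
    ... | inj₂ u≉0 = contradiction sum≈0
                       (>0⇒≉0 (>0+≥0⇒>0 (*-pos 0<p (x≉0⇒0<x*x u≉0)) (*-mono-≥0 0<q (0≤x*x v))))

  0<fromℕ[1+n] : ∀ n → 0# < fromℕ (suc n)
  0<fromℕ[1+n] zero    = <.<-respʳ-≈ (sym (+-identityʳ 1#)) 0<1
  0<fromℕ[1+n] (suc n) = >0+≥0⇒>0 0<1 (inj₁ (0<fromℕ[1+n] n))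

  fromℕ->0 : ∀ {n} → 0 ℕ.< n → 0# < fromℕ n
  fromℕ->0 {suc n} _ = 0<fromℕ[1+n] n

  fromℤ->0 : ∀ {i} → + 0 ℤ.< i → 0# < fromℤ i
  fromℤ->0 {+ suc n}  _               = 0<fromℕ[1+n] n
  fromℤ->0 {+ zero}   (ℤ.+<+ ())
  fromℤ->0 { -[1+ n ]} ()

  fromℤ-<0 : ∀ {i} → i ℤ.< + 0 → fromℤ i < 0#
  fromℤ-<0 { -[1+ n ]} _          = -‿<0 (0<fromℕ[1+n] n)
  fromℤ-<0 {+ n}      (ℤ.+<+ ())

  fromℤ≈0⇒≡0 : ∀ {i} → fromℤ i ≈ 0# → i ≡ + 0
  fromℤ≈0⇒≡0 {+ zero}   _  = ≡.refl
  fromℤ≈0⇒≡0 {+ suc n}  i≈0 = contradiction i≈0 (>0⇒≉0 (0<fromℕ[1+n] n))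
  fromℤ≈0⇒≡0 { -[1+ n ]} i≈0 = contradiction i≈0 (<0⇒≉0 (-‿<0 (0<fromℕ[1+n] n)))

  fromℤ-injective : ∀ {i j} → fromℤ i ≈ fromℤ j → i ≡ j
  fromℤ-injective {i} {j} i≈j = ℤₚ.i-j≡0⇒i≡j i j (fromℤ≈0⇒≡0 (begin
    fromℤ (i ℤ.- j)          ≈⟨ fromℤ-+ i (ℤ.- j) ⟩
    fromℤ i + fromℤ (ℤ.- j)  ≈⟨ +-cong i≈j (fromℤ-neg j) ⟩
    fromℤ j - fromℤ j        ≈⟨ -‿inverseʳ (fromℤ j) ⟩
    0#                       ∎))

module Representations (R : RealField) where
  open RealField R
  open Forms R
  open IntegerEmbedding commutativeRing
  open RealFieldProperties R
  open import Algebra.Properties.CommutativeSemigroup *-commutativeSemigroup using (x∙yz≈y∙xz)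
  open import Relation.Binary.Reasoning.Setoid setoid

  ∑ : (Term → Carrier) → List Term → Carrier
  ∑ f []       = 0#
  ∑ f (t ∷ ts) = f t + ∑ f ts

  moment : ℕ → ℕ → Term → Carrier
  moment n k (l , a , b) = l * (a ^' (n ∸ k) * b ^' k)

  -- The a_k in Σ_(λ,α,β)∈L λ (α x + β y)ⁿ = Σ_k C(n,k) a_k x^(n-k) y^k.
  apolarCoeff : ℕ → List Term → ℕ → Carrier
  apolarCoeff n L k = ∑ (moment n k) L

  ∑-cong : ∀ {f g} → (∀ t → f t ≈ g t) → ∀ L → ∑ f L ≈ ∑ g L
  ∑-cong f≈g []       = refl
  ∑-cong f≈g (t ∷ ts) = +-cong (f≈g t) (∑-cong f≈g ts)

  ∑-++-vanishing : ∀ {f} {P} s → All (λ t → f t ≈ 0#) P → ∑ f (P ++ s ∷ []) ≈ f s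
  ∑-++-vanishing s []              = +-identityʳ _
  ∑-++-vanishing s (ft≈0 ∷ P-zero) = trans (+-cong ft≈0 (∑-++-vanishing s P-zero)) (+-identityˡ _)

  ·≈fromℕ* : ∀ n x → n · x ≈ fromℕ n * x
  ·≈fromℕ* zero    x = sym (zeroˡ x)
  ·≈fromℕ* (suc n) x = begin
    x + n · x               ≈⟨ +-cong (sym (*-identityˡ x)) (·≈fromℕ* n x) ⟩
    1# * x + fromℕ n * x    ≈⟨ distribʳ x 1# (fromℕ n) ⟨
    fromℕ (suc n) * x       ∎

  sumCoeff≈C*apolarCoeff : ∀ n L k → sumCoeff n L k ≈ fromℕ (n C k) * apolarCoeff n L k
  sumCoeff≈C*apolarCoeff n []              k = sym (zeroʳ _)
  sumCoeff≈C*apolarCoeff n (t@(l , a , b) ∷ L) k = begin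
    l * ((n C k) · m) + sumCoeff n L k   ≈⟨ +-cong (*-congˡ (·≈fromℕ* (n C k) m)) (sumCoeff≈C*apolarCoeff n L k) ⟩
    l * (c * m) + c * apolarCoeff n L k  ≈⟨ +-congʳ (x∙yz≈y∙xz l c m) ⟩
    c * (l * m) + c * apolarCoeff n L k  ≈⟨ distribˡ c _ _ ⟨
    c * apolarCoeff n (t ∷ L) k          ∎
    where
    m = a ^' (n ∸ k) * b ^' k
    c = fromℕ (n C k)

  record Honest {n : ℕ} (p : Form n) (L : List Term) : Set where
    field
      nonzero      : All (λ t → coeff t ≉ 0#) L
      distinct     : AllPairs (λ s t → ¬ Proportional s t) L
      represents   : ∀ (k : Fin (suc n)) → p k ≈ sumCoeff n L (toℕ k)

  honest-length-bound : ∀ {n m} {p : Form n} → (∀ L → Honest p L → m ℕ.≤ length L) →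
                        ∀ {c d} → HasBadge p c d → m ℕ.≤ c ℕ.+ d
  honest-length-bound bound (P , N , ∣P∣≡c , ∣N∣≡d , P>0 , N<0 , distinct , represents) =
    ℕₚ.≤-trans (bound (P ++ N) honest)
      (ℕₚ.≤-reflexive (≡.trans (Listₚ.length-++ P) (≡.cong₂ ℕ._+_ ∣P∣≡c ∣N∣≡d)))
    where
    honest : Honest _ (P ++ N)
    honest = record
      { nonzero    = Allₚ.++⁺ (All.map >0⇒≉0 P>0) (All.map <0⇒≉0 N<0)
      ; distinct   = distinct
      ; represents = represents
      }

  badge-minimal : ∀ {n} {p : Form n} {a b} → (∀ {c d} → HasBadge p c d → a ℕ.+ b ℕ.≤ c ℕ.+ d) →
                  HasBadge p a b → IsSignature p a b
  badge-minimal bound badge = badge , λ c d badge′ c≤a d≤b → ≤-sum-squeeze c≤a d≤b (bound badge′)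

  ℤTerm : Set
  ℤTerm = ℤ × ℤ × ℤ

  embed : ℤTerm → Term
  embed (l , a , b) = fromℤ l , fromℤ a , fromℤ b

  sumCoeffℤ : ℕ → List ℤTerm → ℕ → ℤ
  sumCoeffℤ n []                k = + 0
  sumCoeffℤ n ((l , a , b) ∷ L) k = l ℤ.* (+ (n C k) ℤ.* (a ℤ.^ (n ∸ k) ℤ.* b ℤ.^ k)) ℤ.+ sumCoeffℤ n L k

  fromℤ-^ : ∀ a n → fromℤ (a ℤ.^ n) ≈ fromℤ a ^' n
  fromℤ-^ a zero    = +-identityʳ 1#
  fromℤ-^ a (suc n) = trans (fromℤ-* a (a ℤ.^ n)) (*-congˡ (fromℤ-^ a n))

  sumCoeff-embed : ∀ n L k → sumCoeff n (map embed L) k ≈ fromℤ (sumCoeffℤ n L k)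
  sumCoeff-embed n []                k = refl
  sumCoeff-embed n ((l , a , b) ∷ L) k = begin
    termCoeff n (embed (l , a , b)) k + sumCoeff n (map embed L) k  ≈⟨ +-cong term (sumCoeff-embed n L k) ⟩
    fromℤ tℤ + fromℤ (sumCoeffℤ n L k)                               ≈⟨ fromℤ-+ tℤ (sumCoeffℤ n L k) ⟨
    fromℤ (tℤ ℤ.+ sumCoeffℤ n L k)                                    ∎
    where
    tℤ = l ℤ.* (+ (n C k) ℤ.* (a ℤ.^ (n ∸ k) ℤ.* b ℤ.^ k))
    term : termCoeff n (embed (l , a , b)) k ≈ fromℤ tℤ
    term = sym (begin
      fromℤ tℤ
        ≈⟨ fromℤ-* l _ ⟩
      fromℤ l * fromℤ (+ (n C k) ℤ.* (a ℤ.^ (n ∸ k) ℤ.* b ℤ.^ k))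
        ≈⟨ *-congˡ (fromℤ-* (+ (n C k)) _) ⟩
      fromℤ l * (fromℕ (n C k) * fromℤ (a ℤ.^ (n ∸ k) ℤ.* b ℤ.^ k))
        ≈⟨ *-congˡ (*-congˡ (fromℤ-* (a ℤ.^ (n ∸ k)) (b ℤ.^ k))) ⟩
      fromℤ l * (fromℕ (n C k) * (fromℤ (a ℤ.^ (n ∸ k)) * fromℤ (b ℤ.^ k)))
        ≈⟨ *-congˡ (*-congˡ (*-cong (fromℤ-^ a (n ∸ k)) (fromℤ-^ b k))) ⟩
      fromℤ l * (fromℕ (n C k) * (fromℤ a ^' (n ∸ k) * fromℤ b ^' k))
        ≈⟨ *-congˡ (·≈fromℕ* (n C k) _) ⟨
      termCoeff n (embed (l , a , b)) k ∎)

  NonProportionalℤ : ℤTerm → ℤTerm → Set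
  NonProportionalℤ (_ , a , b) (_ , a′ , b′) = ¬ (a ℤ.* b′ ≡ a′ ℤ.* b)

  nonProportionalℤ? : ∀ s t → Dec (NonProportionalℤ s t)
  nonProportionalℤ? (_ , a , b) (_ , a′ , b′) = ¬? (a ℤ.* b′ ℤ.≟ a′ ℤ.* b)

  embed-¬∥ : ∀ {s t} → NonProportionalℤ s t → ¬ Proportional (embed s) (embed t)
  embed-¬∥ {_ , a , b} {_ , a′ , b′} ab′≢a′b ab′≈a′b =
    ab′≢a′b (fromℤ-injective (trans (fromℤ-* a b′) (trans ab′≈a′b (sym (fromℤ-* a′ b)))))

  hasBadge-embed : ∀ {n} {p : Form n} (P N : List ℤTerm) →
    All (λ t → + 0 ℤ.< proj₁ t) P → All (λ t → proj₁ t ℤ.< + 0) N →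
    AllPairs NonProportionalℤ (P ++ N) →
    (∀ (k : Fin (suc n)) → p k ≈ fromℤ (sumCoeffℤ n (P ++ N) (toℕ k))) →
    HasBadge p (length P) (length N)
  hasBadge-embed {n} P N P>0 N<0 distinct represents =
    map embed P , map embed N , Listₚ.length-map embed P , Listₚ.length-map embed N ,
    Allₚ.map⁺ (All.map fromℤ->0 P>0) , Allₚ.map⁺ (All.map fromℤ-<0 N<0) ,
    ≡.subst (AllPairs _) (Listₚ.map-++ embed P N) (AllPairsₚ.map⁺ (AllPairs.map (λ {s} {t} → embed-¬∥ {s} {t}) distinct)) ,
    λ k → trans (represents k) (sym (begin
      sumCoeff n (map embed P ++ map embed N) (toℕ k) ≡⟨ ≡.cong (λ L → sumCoeff n L (toℕ k)) (Listₚ.map-++ embed P N) ⟨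
      sumCoeff n (map embed (P ++ N)) (toℕ k)         ≈⟨ sumCoeff-embed n (P ++ N) (toℕ k) ⟩
      fromℤ (sumCoeffℤ n (P ++ N) (toℕ k))           ∎))

module SexticApolarity (R : RealField) where
  open RealField R
  open Forms R
  open IntegerEmbedding commutativeRing
  open RealFieldProperties R
  open Representations R
  open ℤ-Solver
  open import Algebra.Properties.Ring ring using (+-cancelˡ; +-cancelʳ; x∙y⁻¹≈ε⇒x≈y)
  open import Relation.Binary.Reasoning.Setoid setoid

  record Cubic : Set where
    constructor cubic
    field w₀ w₁ w₂ w₃ : Carrier

  eval : Cubic → Term → Carrier
  eval (cubic w₀ w₁ w₂ w₃) (_ , x , y) = w₀ * x ^' 3 + w₁ * (x ^' 2 * y) + w₂ * (x * y ^' 2) + w₃ * y ^' 3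

  Root : Cubic → Term → Set
  Root w t = eval w t ≈ 0#

  contract : Cubic → (ℕ → Carrier) → ℕ → Carrier
  contract (cubic w₀ w₁ w₂ w₃) A k = w₀ * A k + w₁ * A (1 ℕ.+ k) + w₂ * A (2 ℕ.+ k) + w₃ * A (3 ℕ.+ k)

  contract-cong : ∀ w A B k → A k ≈ B k → A (1 ℕ.+ k) ≈ B (1 ℕ.+ k) → A (2 ℕ.+ k) ≈ B (2 ℕ.+ k) →
                  A (3 ℕ.+ k) ≈ B (3 ℕ.+ k) → contract w A k ≈ contract w B k
  contract-cong (cubic w₀ w₁ w₂ w₃) A B k e₀ e₁ e₂ e₃ =
    +-cong (+-cong (+-cong (*-congˡ e₀) (*-congˡ e₁)) (*-congˡ e₂)) (*-congˡ e₃)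

  contract-∑ : ∀ w (f : ℕ → Term → Carrier) L k →
               contract w (λ j → ∑ (f j) L) k ≈ ∑ (λ t → contract w (λ j → f j t) k) L
  contract-∑ (cubic w₀ w₁ w₂ w₃) f [] k =
    solve 4 (λ w₀ w₁ w₂ w₃ → w₀ :* con (+ 0) :+ w₁ :* con (+ 0) :+ w₂ :* con (+ 0) :+ w₃ :* con (+ 0) := con (+ 0))
      refl w₀ w₁ w₂ w₃
  contract-∑ w@(cubic w₀ w₁ w₂ w₃) f (t ∷ L) k =
    trans (distribute w₀ w₁ w₂ w₃ (f k t) (f (1 ℕ.+ k) t) (f (2 ℕ.+ k) t) (f (3 ℕ.+ k) t) _ _ _ _)
          (+-congˡ (contract-∑ w f L k))
    where
    distribute : ∀ w₀ w₁ w₂ w₃ x₀ x₁ x₂ x₃ y₀ y₁ y₂ y₃ →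
      w₀ * (x₀ + y₀) + w₁ * (x₁ + y₁) + w₂ * (x₂ + y₂) + w₃ * (x₃ + y₃)
        ≈ (w₀ * x₀ + w₁ * x₁ + w₂ * x₂ + w₃ * x₃) + (w₀ * y₀ + w₁ * y₁ + w₂ * y₂ + w₃ * y₃)
    distribute = solve 12 (λ w₀ w₁ w₂ w₃ x₀ x₁ x₂ x₃ y₀ y₁ y₂ y₃ →
      w₀ :* (x₀ :+ y₀) :+ w₁ :* (x₁ :+ y₁) :+ w₂ :* (x₂ :+ y₂) :+ w₃ :* (x₃ :+ y₃)
        := (w₀ :* x₀ :+ w₁ :* x₁ :+ w₂ :* x₂ :+ w₃ :* x₃) :+ (w₀ :* y₀ :+ w₁ :* y₁ :+ w₂ :* y₂ :+ w₃ :* y₃)) refl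

  contract-moment : ∀ w t (k : Fin 4) → contract w (λ j → moment 6 j t) (toℕ k) ≈ moment 3 (toℕ k) t * eval w t
  contract-moment (cubic w₀ w₁ w₂ w₃) (l , a , b) 0F = solve 7 (λ w₀ w₁ w₂ w₃ l a b →
      w₀ :* (l :* (a :^ 6 :* b :^ 0)) :+ w₁ :* (l :* (a :^ 5 :* b :^ 1)) :+ w₂ :* (l :* (a :^ 4 :* b :^ 2)) :+ w₃ :* (l :* (a :^ 3 :* b :^ 3))
        := (l :* (a :^ 3 :* b :^ 0)) :* (w₀ :* a :^ 3 :+ w₁ :* (a :^ 2 :* b) :+ w₂ :* (a :* b :^ 2) :+ w₃ :* b :^ 3)) refl w₀ w₁ w₂ w₃ l a b
  contract-moment (cubic w₀ w₁ w₂ w₃) (l , a , b) 1F = solve 7 (λ w₀ w₁ w₂ w₃ l a b →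
      w₀ :* (l :* (a :^ 5 :* b :^ 1)) :+ w₁ :* (l :* (a :^ 4 :* b :^ 2)) :+ w₂ :* (l :* (a :^ 3 :* b :^ 3)) :+ w₃ :* (l :* (a :^ 2 :* b :^ 4))
        := (l :* (a :^ 2 :* b :^ 1)) :* (w₀ :* a :^ 3 :+ w₁ :* (a :^ 2 :* b) :+ w₂ :* (a :* b :^ 2) :+ w₃ :* b :^ 3)) refl w₀ w₁ w₂ w₃ l a b
  contract-moment (cubic w₀ w₁ w₂ w₃) (l , a , b) 2F = solve 7 (λ w₀ w₁ w₂ w₃ l a b →
      w₀ :* (l :* (a :^ 4 :* b :^ 2)) :+ w₁ :* (l :* (a :^ 3 :* b :^ 3)) :+ w₂ :* (l :* (a :^ 2 :* b :^ 4)) :+ w₃ :* (l :* (a :^ 1 :* b :^ 5))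
        := (l :* (a :^ 1 :* b :^ 2)) :* (w₀ :* a :^ 3 :+ w₁ :* (a :^ 2 :* b) :+ w₂ :* (a :* b :^ 2) :+ w₃ :* b :^ 3)) refl w₀ w₁ w₂ w₃ l a b
  contract-moment (cubic w₀ w₁ w₂ w₃) (l , a , b) 3F = solve 7 (λ w₀ w₁ w₂ w₃ l a b →
      w₀ :* (l :* (a :^ 3 :* b :^ 3)) :+ w₁ :* (l :* (a :^ 2 :* b :^ 4)) :+ w₂ :* (l :* (a :^ 1 :* b :^ 5)) :+ w₃ :* (l :* (a :^ 0 :* b :^ 6))
        := (l :* (a :^ 0 :* b :^ 3)) :* (w₀ :* a :^ 3 :+ w₁ :* (a :^ 2 :* b) :+ w₂ :* (a :* b :^ 2) :+ w₃ :* b :^ 3)) refl w₀ w₁ w₂ w₃ l a b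

  contract-apolarCoeff : ∀ w L (k : Fin 4) →
    contract w (apolarCoeff 6 L) (toℕ k) ≈ ∑ (λ t → moment 3 (toℕ k) t * eval w t) L
  contract-apolarCoeff w L k =
    trans (contract-∑ w (moment 6) L (toℕ k)) (∑-cong (λ t → contract-moment w t k) L)

  -- A term (λ, α, β) doubles as the point (α, β); λ is ignored.
  line : Term → Term → Carrier
  line (_ , a , b) (_ , x , y) = b * x - a * y

  line-self : ∀ r → line r r ≈ 0#
  line-self (_ , a , b) = solve 2 (λ a b → b :* a :- a :* b := con (+ 0)) refl a b

  ∦⇒line≉0 : ∀ r u → ¬ Proportional r u → line r u ≉ 0#
  ∦⇒line≉0 (_ , a , b) (_ , x , y) r∦u line≈0 =
    r∦u (sym (trans (*-comm x b) (x∙y⁻¹≈ε⇒x≈y (b * x) (a * y) line≈0)))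

  cubicThrough : Term → Term → Term → Cubic
  cubicThrough (_ , a₁ , b₁) (_ , a₂ , b₂) (_ , a₃ , b₃) = cubic
    (b₁ * b₂ * b₃)
    (- (a₁ * b₂ * b₃ + b₁ * a₂ * b₃ + b₁ * b₂ * a₃))
    (a₁ * a₂ * b₃ + a₁ * b₂ * a₃ + b₁ * a₂ * a₃)
    (- (a₁ * a₂ * a₃))

  eval-cubicThrough : ∀ r₁ r₂ r₃ u → eval (cubicThrough r₁ r₂ r₃) u ≈ line r₁ u * line r₂ u * line r₃ u
  eval-cubicThrough (_ , a₁ , b₁) (_ , a₂ , b₂) (_ , a₃ , b₃) (_ , x , y) = solve 8 (λ a₁ b₁ a₂ b₂ a₃ b₃ x y →
      (b₁ :* b₂ :* b₃) :* x :^ 3 :+ (:- (a₁ :* b₂ :* b₃ :+ b₁ :* a₂ :* b₃ :+ b₁ :* b₂ :* a₃)) :* (x :^ 2 :* y)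
        :+ (a₁ :* a₂ :* b₃ :+ a₁ :* b₂ :* a₃ :+ b₁ :* a₂ :* a₃) :* (x :* y :^ 2) :+ (:- (a₁ :* a₂ :* a₃)) :* y :^ 3
      := (b₁ :* x :- a₁ :* y) :* (b₂ :* x :- a₂ :* y) :* (b₃ :* x :- a₃ :* y)) refl a₁ b₁ a₂ b₂ a₃ b₃ x y

  cubicThrough-root₁ : ∀ r₁ r₂ r₃ → Root (cubicThrough r₁ r₂ r₃) r₁
  cubicThrough-root₁ r₁ r₂ r₃ = trans (eval-cubicThrough r₁ r₂ r₃ r₁)
    (trans (*-congʳ (trans (*-congʳ (line-self r₁)) (zeroˡ _))) (zeroˡ _))

  cubicThrough-root₂ : ∀ r₁ r₂ r₃ → Root (cubicThrough r₁ r₂ r₃) r₂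
  cubicThrough-root₂ r₁ r₂ r₃ = trans (eval-cubicThrough r₁ r₂ r₃ r₂)
    (trans (*-congʳ (trans (*-congˡ (line-self r₂)) (zeroʳ _))) (zeroˡ _))

  cubicThrough-root₃ : ∀ r₁ r₂ r₃ → Root (cubicThrough r₁ r₂ r₃) r₃
  cubicThrough-root₃ r₁ r₂ r₃ = trans (eval-cubicThrough r₁ r₂ r₃ r₃) (trans (*-congˡ (line-self r₃)) (zeroʳ _))

  cubicThrough-≉0 : ∀ r₁ r₂ r₃ u → ¬ Proportional r₁ u → ¬ Proportional r₂ u → ¬ Proportional r₃ u →
                    eval (cubicThrough r₁ r₂ r₃) u ≉ 0#
  cubicThrough-≉0 r₁ r₂ r₃ u r₁∦u r₂∦u r₃∦u eval≈0 =
    *-≉0 (*-≉0 (∦⇒line≉0 r₁ u r₁∦u) (∦⇒line≉0 r₂ u r₂∦u)) (∦⇒line≉0 r₃ u r₃∦u)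
      (trans (sym (eval-cubicThrough r₁ r₂ r₃ u)) eval≈0)

  chord : Term → Term → Term
  chord (_ , a , b) (_ , a′ , b′) = 0# , a + a′ , b + b′

  chord-∦ˡ : ∀ t u → ¬ Proportional t u → ¬ Proportional t (chord t u)
  chord-∦ˡ (_ , a , b) (_ , a′ , b′) t∦u t∥chord = t∦u (+-cancelˡ (a * b) (a * b′) (a′ * b) (begin
    a * b + a * b′    ≈⟨ distribˡ a b b′ ⟨
    a * (b + b′)      ≈⟨ t∥chord ⟩
    (a + a′) * b      ≈⟨ distribʳ b a a′ ⟩
    a * b + a′ * b    ∎))

  chord-∦ʳ : ∀ t u → ¬ Proportional t u → ¬ Proportional (chord t u) u
  chord-∦ʳ (_ , a , b) (_ , a′ , b′) t∦u chord∥u = t∦u (+-cancelʳ (a′ * b′) (a * b′) (a′ * b) (begin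
    a * b′ + a′ * b′  ≈⟨ distribʳ b′ a a′ ⟨
    (a + a′) * b′     ≈⟨ chord∥u ⟩
    a′ * (b + b′)     ≈⟨ distribˡ a′ b b′ ⟩
    a′ * b + a′ * b′  ∎))

  lincomb-≈0 : ∀ {e u v} p q → e ≈ p * u + q * v → u ≈ 0# → v ≈ 0# → e ≈ 0#
  lincomb-≈0 {e} {u} {v} p q e≈ u≈0 v≈0 = begin
    e              ≈⟨ e≈ ⟩
    p * u + q * v  ≈⟨ +-cong (*-congˡ u≈0) (*-congˡ v≈0) ⟩
    p * 0# + q * 0# ≈⟨ solve 2 (λ p q → p :* con (+ 0) :+ q :* con (+ 0) := con (+ 0)) refl p q ⟩
    0#             ∎

  -- r lies on the line through the reflection (a, -b) of s, or s and r lie on different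
  -- coordinate axes (or one of them is 0).
  Mirror : Term → Term → Set
  Mirror (_ , a , b) (_ , x , y) = (b * x + a * y ≈ 0#) ⊎ (a * x ≈ 0# × b * y ≈ 0#)

  two-mirror-lines : ∀ {a b x₁ y₁ x₂ y₂} → b * x₁ + a * y₁ ≈ 0# → b * x₂ + a * y₂ ≈ 0# →
                     ¬ (x₁ * y₂ ≈ x₂ * y₁) → a ≈ 0# × b ≈ 0#
  two-mirror-lines {a} {b} {x₁} {y₁} {x₂} {y₂} e₁ e₂ x₁y₂≉x₂y₁ =
    *-cancelʳ-≈0 det≉0 (lincomb-≈0 x₁ (- x₂) (solve 6 (λ a b x₁ y₁ x₂ y₂ →
      a :* (x₁ :* y₂ :- x₂ :* y₁) := x₁ :* (b :* x₂ :+ a :* y₂) :+ (:- x₂) :* (b :* x₁ :+ a :* y₁)) refl a b x₁ y₁ x₂ y₂) e₂ e₁) ,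
    *-cancelʳ-≈0 det≉0 (lincomb-≈0 y₂ (- y₁) (solve 6 (λ a b x₁ y₁ x₂ y₂ →
      b :* (x₁ :* y₂ :- x₂ :* y₁) := y₂ :* (b :* x₁ :+ a :* y₁) :+ (:- y₁) :* (b :* x₂ :+ a :* y₂)) refl a b x₁ y₁ x₂ y₂) e₁ e₂)
    where det≉0 = ≉⇒-≉0 x₁y₂≉x₂y₁

  axis-mirror⇒ab≈0 : ∀ {a b x y} → a * x ≈ 0# → b * y ≈ 0# → ¬ (x * b ≈ a * y) → a * b ≈ 0#
  axis-mirror⇒ab≈0 {a} {b} {x} {y} ax≈0 by≈0 xb≉ay = *-cancelʳ-≈0 (≉⇒-≉0 xb≉ay)
    (lincomb-≈0 (b * b) (- (a * a)) (solve 4 (λ a b x y →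
      (a :* b) :* (x :* b :- a :* y) := (b :* b) :* (a :* x) :+ (:- (a :* a)) :* (b :* y)) refl a b x y) ax≈0 by≈0)

  mirror-a≈0⇒y≈0 : ∀ s r → proj₁ (proj₂ s) ≈ 0# → Mirror s r → ¬ Proportional r s → proj₂ (proj₂ r) ≈ 0#
  mirror-a≈0⇒y≈0 (_ , a , b) (_ , x , y) a≈0 (inj₁ bx+ay≈0) r∦s = ⊥-elim (≉⇒-≉0 r∦s
    (lincomb-≈0 (fromℤ (+ 1)) (- (y + y)) (solve 4 (λ a b x y →
      x :* b :- a :* y := con (+ 1) :* (b :* x :+ a :* y) :+ (:- (y :+ y)) :* a) refl a b x y) bx+ay≈0 a≈0))
  mirror-a≈0⇒y≈0 (_ , a , b) (_ , x , y) a≈0 (inj₂ (_ , by≈0)) r∦s = *-cancelˡ-≈0 (≉⇒-≉0 r∦s)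
    (lincomb-≈0 x (- (y * y)) (solve 4 (λ a b x y →
      (x :* b :- a :* y) :* y := x :* (b :* y) :+ (:- (y :* y)) :* a) refl a b x y) by≈0 a≈0)

  mirror-b≈0⇒x≈0 : ∀ s r → proj₂ (proj₂ s) ≈ 0# → Mirror s r → ¬ Proportional r s → proj₁ (proj₂ r) ≈ 0#
  mirror-b≈0⇒x≈0 (_ , a , b) (_ , x , y) b≈0 (inj₁ bx+ay≈0) r∦s = ⊥-elim (≉⇒-≉0 r∦s
    (lincomb-≈0 (- fromℤ (+ 1)) (x + x) (solve 4 (λ a b x y →
      x :* b :- a :* y := (:- con (+ 1)) :* (b :* x :+ a :* y) :+ (x :+ x) :* b) refl a b x y) bx+ay≈0 b≈0))
  mirror-b≈0⇒x≈0 (_ , a , b) (_ , x , y) b≈0 (inj₂ (ax≈0 , _)) r∦s = *-cancelˡ-≈0 (≉⇒-≉0 r∦s)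
    (lincomb-≈0 (x * x) (- y) (solve 4 (λ a b x y →
      (x :* b :- a :* y) :* x := (x :* x) :* b :+ (:- y) :* (a :* x)) refl a b x y) b≈0 ax≈0)

  axis-mirrors-∥ : ∀ s r₁ r₂ → proj₁ (proj₂ s) * proj₂ (proj₂ s) ≈ 0# → Mirror s r₁ → Mirror s r₂ →
                   ¬ Proportional r₁ s → ¬ Proportional r₂ s → Proportional r₁ r₂
  axis-mirrors-∥ s@(_ , a , b) r₁@(_ , x₁ , y₁) r₂@(_ , x₂ , y₂) ab≈0 mirror₁ mirror₂ r₁∦s r₂∦s
    with zero-product ab≈0
  ... | inj₁ a≈0 = trans (trans (*-congˡ (mirror-a≈0⇒y≈0 s r₂ a≈0 mirror₂ r₂∦s)) (zeroʳ x₁))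
                         (sym (trans (*-congˡ (mirror-a≈0⇒y≈0 s r₁ a≈0 mirror₁ r₁∦s)) (zeroʳ x₂)))
  ... | inj₂ b≈0 = trans (trans (*-congʳ (mirror-b≈0⇒x≈0 s r₁ b≈0 mirror₁ r₁∦s)) (zeroˡ y₂))
                         (sym (trans (*-congʳ (mirror-b≈0⇒x≈0 s r₂ b≈0 mirror₂ r₂∦s)) (zeroˡ y₁)))

  no-two-mirrors : ∀ s r₁ r₂ → Mirror s r₁ → Mirror s r₂ →
                   ¬ Proportional r₁ r₂ → ¬ Proportional r₁ s → ¬ Proportional r₂ s → ⊥
  no-two-mirrors (_ , a , b) (_ , x₁ , y₁) (_ , x₂ , y₂) (inj₁ e₁) (inj₁ e₂) r₁∦r₂ r₁∦s r₂∦s =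
    r₁∦s (trans (trans (*-congˡ b≈0) (zeroʳ x₁)) (sym (trans (*-congʳ a≈0) (zeroˡ y₁))))
    where
    a≈0×b≈0 = two-mirror-lines {a} {b} {x₁} {y₁} {x₂} {y₂} e₁ e₂ r₁∦r₂
    a≈0 = proj₁ a≈0×b≈0
    b≈0 = proj₂ a≈0×b≈0
  no-two-mirrors s@(_ , a , b) r₁@(_ , x₁ , y₁) r₂ mirror₁@(inj₂ (ax₁≈0 , by₁≈0)) mirror₂ r₁∦r₂ r₁∦s r₂∦s =
    r₁∦r₂ (axis-mirrors-∥ s r₁ r₂ (axis-mirror⇒ab≈0 {a} {b} {x₁} {y₁} ax₁≈0 by₁≈0 r₁∦s) mirror₁ mirror₂ r₁∦s r₂∦s)
  no-two-mirrors s@(_ , a , b) r₁ r₂@(_ , x₂ , y₂) mirror₁@(inj₁ _) mirror₂@(inj₂ (ax₂≈0 , by₂≈0)) r₁∦r₂ r₁∦s r₂∦s =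
    r₁∦r₂ (axis-mirrors-∥ s r₁ r₂ (axis-mirror⇒ab≈0 {a} {b} {x₂} {y₂} ax₂≈0 by₂≈0 r₂∦s) mirror₁ mirror₂ r₁∦s r₂∦s)

  module Target (κ₁ κ₅ : ℕ) (0<κ₁ : 0 ℕ.< κ₁) (0<κ₅ : 0 ℕ.< κ₅) where

    target : ℕ → ℕ
    target 1 = κ₁
    target 5 = κ₅
    target _ = 0

    τ : ℕ → Carrier
    τ k = fromℕ (target k)

    MatchesTarget : List Term → Set
    MatchesTarget L = ∀ (k : Fin 7) → apolarCoeff 6 L (toℕ k) ≈ τ (toℕ k)

    contract-target : ∀ L w → MatchesTarget L → ∀ (k : Fin 4) →
                      contract w (apolarCoeff 6 L) (toℕ k) ≈ contract w τ (toℕ k)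
    contract-target L w matches 0F = contract-cong w (apolarCoeff 6 L) τ 0 (matches 0F) (matches 1F) (matches 2F) (matches 3F)
    contract-target L w matches 1F = contract-cong w (apolarCoeff 6 L) τ 1 (matches 1F) (matches 2F) (matches 3F) (matches 4F)
    contract-target L w matches 2F = contract-cong w (apolarCoeff 6 L) τ 2 (matches 2F) (matches 3F) (matches 4F) (matches 5F)
    contract-target L w matches 3F = contract-cong w (apolarCoeff 6 L) τ 3 (matches 3F) (matches 4F) (matches 5F) (matches 6F)

    root⇒mirror : ∀ w s r → (∀ (k : Fin 4) → contract w τ (toℕ k) ≈ moment 3 (toℕ k) s * eval w s) →
                  coeff s ≉ 0# → eval w s ≉ 0# → Root w r → Mirror s r
    root⇒mirror w@(cubic w₀ w₁ w₂ w₃) s@(l , a , b) r@(_ , x , y) relation l≉0 e≉0 root =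
      Sum.map₂ (weighted-squares-≈0 (fromℕ->0 0<κ₅) (fromℕ->0 0<κ₁))
        (zero-product (*-cancelˡ-≈0 (*-≉0 l≉0 e≉0) factorisation))
      where
      c₁ = fromℕ κ₁
      c₅ = fromℕ κ₅
      e = eval w s
      factorisation : (l * e) * ((b * x + a * y) * (c₅ * ((a * x) * (a * x)) + c₁ * ((b * y) * (b * y)))) ≈ 0#
      factorisation = begin
        (l * e) * ((b * x + a * y) * (c₅ * ((a * x) * (a * x)) + c₁ * ((b * y) * (b * y))))
          ≈⟨ solve 8 (λ l e a b x y c₁ c₅ →
               (l :* e) :* ((b :* x :+ a :* y) :* (c₅ :* ((a :* x) :* (a :* x)) :+ c₁ :* ((b :* y) :* (b :* y))))
               := c₅ :* x :^ 3 :* ((l :* (a :^ 2 :* b :^ 1)) :* e) :+ c₅ :* (x :^ 2 :* y) :* ((l :* (a :^ 3 :* b :^ 0)) :* e)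
                  :+ c₁ :* (x :* y :^ 2) :* ((l :* (a :^ 0 :* b :^ 3)) :* e) :+ c₁ :* y :^ 3 :* ((l :* (a :^ 1 :* b :^ 2)) :* e))
             refl l e a b x y c₁ c₅ ⟩
        c₅ * x ^' 3 * (moment 3 1 s * e) + c₅ * (x ^' 2 * y) * (moment 3 0 s * e)
          + c₁ * (x * y ^' 2) * (moment 3 3 s * e) + c₁ * y ^' 3 * (moment 3 2 s * e)
          ≈⟨ +-cong (+-cong (+-cong (*-congˡ (relation 1F)) (*-congˡ (relation 0F))) (*-congˡ (relation 3F))) (*-congˡ (relation 2F)) ⟨
        c₅ * x ^' 3 * contract w τ 1 + c₅ * (x ^' 2 * y) * contract w τ 0
          + c₁ * (x * y ^' 2) * contract w τ 3 + c₁ * y ^' 3 * contract w τ 2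
          ≈⟨ solve 8 (λ w₀ w₁ w₂ w₃ x y c₁ c₅ →
               c₅ :* x :^ 3 :* (w₀ :* c₁ :+ w₁ :* con (+ 0) :+ w₂ :* con (+ 0) :+ w₃ :* con (+ 0))
                 :+ c₅ :* (x :^ 2 :* y) :* (w₀ :* con (+ 0) :+ w₁ :* c₁ :+ w₂ :* con (+ 0) :+ w₃ :* con (+ 0))
                 :+ c₁ :* (x :* y :^ 2) :* (w₀ :* con (+ 0) :+ w₁ :* con (+ 0) :+ w₂ :* c₅ :+ w₃ :* con (+ 0))
                 :+ c₁ :* y :^ 3 :* (w₀ :* con (+ 0) :+ w₁ :* con (+ 0) :+ w₂ :* con (+ 0) :+ w₃ :* c₅)
               := (c₁ :* c₅) :* (w₀ :* x :^ 3 :+ w₁ :* (x :^ 2 :* y) :+ w₂ :* (x :* y :^ 2) :+ w₃ :* y :^ 3))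
             refl w₀ w₁ w₂ w₃ x y c₁ c₅ ⟩
        (c₁ * c₅) * eval w r ≈⟨ *-congˡ root ⟩
        (c₁ * c₅) * 0#       ≈⟨ zeroʳ _ ⟩
        0#                   ∎

    survivor-mirrors : ∀ w P s → MatchesTarget (P ++ s ∷ []) → All (Root w) P →
                       coeff s ≉ 0# → eval w s ≉ 0# → ∀ r → Root w r → Mirror s r
    survivor-mirrors w P s matches P-roots s≉0 e≉0 r = root⇒mirror w s r relation s≉0 e≉0
      where
      L = P ++ s ∷ []
      relation : ∀ (k : Fin 4) → contract w τ (toℕ k) ≈ moment 3 (toℕ k) s * eval w s
      relation k = begin
        contract w τ (toℕ k)                        ≈⟨ contract-target L w matches k ⟨
        contract w (apolarCoeff 6 L) (toℕ k)        ≈⟨ contract-apolarCoeff w L k ⟩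
        ∑ (λ t → moment 3 (toℕ k) t * eval w t) L  ≈⟨ ∑-++-vanishing s (All.map vanishes P-roots) ⟩
        moment 3 (toℕ k) s * eval w s               ∎
        where
        vanishes : ∀ {t} → Root w t → moment 3 (toℕ k) t * eval w t ≈ 0#
        vanishes {t} root = trans (*-congˡ root) (zeroʳ (moment 3 (toℕ k) t))

    single-survivor-impossible : ∀ P r₁ r₂ r₃ s → MatchesTarget (P ++ s ∷ []) → All (Root (cubicThrough r₁ r₂ r₃)) P →
                  coeff s ≉ 0# → ¬ Proportional r₁ r₂ → ¬ Proportional r₁ s → ¬ Proportional r₂ s →
                  ¬ Proportional r₃ s → ⊥
    single-survivor-impossible P r₁ r₂ r₃ s matches P-roots s≉0 r₁∦r₂ r₁∦s r₂∦s r₃∦s =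
      no-two-mirrors s r₁ r₂ (mirror r₁ (cubicThrough-root₁ r₁ r₂ r₃)) (mirror r₂ (cubicThrough-root₂ r₁ r₂ r₃))
        r₁∦r₂ r₁∦s r₂∦s
      where
      mirror = survivor-mirrors (cubicThrough r₁ r₂ r₃) P s matches P-roots s≉0
                 (cubicThrough-≉0 r₁ r₂ r₃ s r₁∦s r₂∦s r₃∦s)

    one-term-apolar : ∀ t → let A = apolarCoeff 6 (t ∷ []) in A 1 * A 1 ≈ A 0 * A 2
    one-term-apolar (l , a , b) = solve 3 (λ l a b →
      (l :* (a :^ 5 :* b :^ 1) :+ con (+ 0)) :* (l :* (a :^ 5 :* b :^ 1) :+ con (+ 0))
        := (l :* (a :^ 6 :* b :^ 0) :+ con (+ 0)) :* (l :* (a :^ 4 :* b :^ 2) :+ con (+ 0))) refl l a b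

    c₁≉0 : fromℕ κ₁ ≉ 0#
    c₁≉0 = >0⇒≉0 (fromℕ->0 0<κ₁)

    -- With two terms the chord t₁ + t₂ supplies the second root of the cubic.
    no-short-representation : ∀ L → length L ℕ.≤ 4 → All (λ t → coeff t ≉ 0#) L →
                              AllPairs (λ s t → ¬ Proportional s t) L → MatchesTarget L → ⊥
    no-short-representation [] _ _ _ matches = c₁≉0 (sym (matches 1F))
    no-short-representation (t ∷ []) _ _ _ matches = *-≉0 c₁≉0 c₁≉0 (begin
      fromℕ κ₁ * fromℕ κ₁  ≈⟨ *-cong (matches 1F) (matches 1F) ⟨
      A 1 * A 1            ≈⟨ one-term-apolar t ⟩
      A 0 * A 2            ≈⟨ *-congʳ (matches 0F) ⟩
      0# * A 2             ≈⟨ zeroˡ (A 2) ⟩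
      0#                   ∎)
      where A = apolarCoeff 6 (t ∷ [])
    no-short-representation (t₁ ∷ t₂ ∷ []) _ (_ ∷ t₂≉0 ∷ []) ((t₁∦t₂ ∷ []) ∷ _) matches =
      single-survivor-impossible (t₁ ∷ []) t₁ (chord t₁ t₂) t₁ t₂ matches (cubicThrough-root₁ t₁ (chord t₁ t₂) t₁ ∷ []) t₂≉0
        (chord-∦ˡ t₁ t₂ t₁∦t₂) t₁∦t₂ (chord-∦ʳ t₁ t₂ t₁∦t₂) t₁∦t₂
    no-short-representation (t₁ ∷ t₂ ∷ t₃ ∷ []) _ (_ ∷ _ ∷ t₃≉0 ∷ []) ((t₁∦t₂ ∷ t₁∦t₃ ∷ []) ∷ (t₂∦t₃ ∷ []) ∷ _) matches =
      single-survivor-impossible (t₁ ∷ t₂ ∷ []) t₁ t₂ t₁ t₃ matches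
        (cubicThrough-root₁ t₁ t₂ t₁ ∷ cubicThrough-root₂ t₁ t₂ t₁ ∷ []) t₃≉0 t₁∦t₂ t₁∦t₃ t₂∦t₃ t₁∦t₃
    no-short-representation (t₁ ∷ t₂ ∷ t₃ ∷ t₄ ∷ []) _ (_ ∷ _ ∷ _ ∷ t₄≉0 ∷ [])
                            ((t₁∦t₂ ∷ _ ∷ t₁∦t₄ ∷ []) ∷ (_ ∷ t₂∦t₄ ∷ []) ∷ (t₃∦t₄ ∷ []) ∷ _) matches =
      single-survivor-impossible (t₁ ∷ t₂ ∷ t₃ ∷ []) t₁ t₂ t₃ t₄ matches
        (cubicThrough-root₁ t₁ t₂ t₃ ∷ cubicThrough-root₂ t₁ t₂ t₃ ∷ cubicThrough-root₃ t₁ t₂ t₃ ∷ [])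
        t₄≉0 t₁∦t₂ t₁∦t₄ t₂∦t₄ t₃∦t₄
    no-short-representation (_ ∷ _ ∷ _ ∷ _ ∷ _ ∷ _) (ℕ.s≤s (ℕ.s≤s (ℕ.s≤s (ℕ.s≤s ())))) _ _ _

module SexticWithTwoSignatures (R : RealField) where
  open RealField R
  open Forms R
  open IntegerEmbedding commutativeRing
  open RealFieldProperties R
  open Representations R
  open SexticApolarity R
  open Target 1008 2268 ℕ.z<s ℕ.z<s
  open import Relation.Binary.Reasoning.Setoid setoid

  q : Form 6
  q k = fromℕ ((6 C toℕ k) ℕ.* target (toℕ k))

  0<6Ck : ∀ (k : Fin 7) → 0 ℕ.< 6 C toℕ k
  0<6Ck = from-yes (Finₚ.all? λ (k : Fin 7) → 0 ℕ.<? 6 C toℕ k)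

  honest⇒matches : ∀ {L} → Honest q L → MatchesTarget L
  honest⇒matches {L} honest k = *-cancelˡ (>0⇒≉0 (fromℕ->0 (0<6Ck k))) (begin
    fromℕ (6 C toℕ k) * apolarCoeff 6 L (toℕ k)  ≈⟨ sumCoeff≈C*apolarCoeff 6 L (toℕ k) ⟨
    sumCoeff 6 L (toℕ k)                          ≈⟨ Honest.represents honest k ⟨
    q k                                           ≈⟨ fromℕ-* (6 C toℕ k) (target (toℕ k)) ⟩
    fromℕ (6 C toℕ k) * τ (toℕ k)                 ∎)

  q-badge-size : ∀ {c d} → HasBadge q c d → 5 ℕ.≤ c ℕ.+ d
  q-badge-size = honest-length-bound λ L honest → ℕₚ.≰⇒> λ ∣L∣≤4 →
    no-short-representation L ∣L∣≤4 (Honest.nonzero honest) (Honest.distinct honest) (honest⇒matches honest)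

  q-badge : ∀ P N
    {_ : True (All.all? (λ t → + 0 ℤ.<? proj₁ t) P)}
    {_ : True (All.all? (λ t → proj₁ t ℤ.<? + 0) N)}
    {_ : True (AllPairs.allPairs? nonProportionalℤ? (P ++ N))}
    {_ : True (Finₚ.all? λ (k : Fin 7) → + ((6 C toℕ k) ℕ.* target (toℕ k)) ℤ.≟ sumCoeffℤ 6 (P ++ N) (toℕ k))} →
    HasBadge q (length P) (length N)
  q-badge P N {P>0} {N<0} {distinct} {coeffs} =
    hasBadge-embed P N (toWitness P>0) (toWitness N<0) (toWitness distinct)
      (λ k → reflexive (≡.cong fromℤ (toWitness coeffs k)))

  badge₃₂ : HasBadge q 3 2
  badge₃₂ = q-badge
    ((+ 2268 , -[1+ 0 ] , + 1) ∷ (+ 3360 , + 1 , + 0) ∷ (+ 4 , + 1 , + 3) ∷ [])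
    ((-[1+ 80 ] , -[1+ 1 ] , + 1) ∷ (-[1+ 6 ] , -[1+ 1 ] , + 3) ∷ [])

  badge₂₃ : HasBadge q 2 3
  badge₂₃ = q-badge
    ((+ 81 , + 2 , + 1) ∷ (+ 7 , + 2 , + 3) ∷ [])
    ((-[1+ 3 ] , -[1+ 0 ] , + 3) ∷ (-[1+ 3359 ] , + 1 , + 0) ∷ (-[1+ 2267 ] , + 1 , + 1) ∷ [])

corollary4p5 : (R : RealField) → let open Forms R in
    Σ (Form 6) λ q → Σ ℕ λ a → Σ ℕ λ b → Σ ℕ λ c → Σ ℕ λ d →
    IsSignature q a b × IsSignature q c d × ¬ ((a , b) ≡ (c , d))
corollary4p5 R = q , 3 , 2 , 2 , 3 , badge-minimal q-badge-size badge₃₂ , badge-minimal q-badge-size badge₂₃ , λ ()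
  where
  open Representations R using (badge-minimal)
  open SexticWithTwoSignatures R
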